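{- The functors $\mathrm{K}$ and $\mathrm{C}$ establish a categorical equivalence between the category $\mathsf{tDLI}^{+}_{0}$ and the category $\mathsf{itKI}_{c}$, with natural isomorphisms $\alpha$ and $\beta$. Here $\alpha_{\mathbf{L}}:\mathbf{L}\to \mathrm{C}(\mathrm{K}(\mathbf{L}))$ is $\alpha_{\mathbf{L}}(x)=(x,0)$ and $\beta_{\mathbf{U}}:\mathbf{U}\to \mathrm{K}(\mathrm{C}(\mathbf{U}))$ is $\beta_{\mathbf{U}}(x)=(x\vee c,\sim x\vee c)$.
   Context: A DLI-algebra is an algebra $\langle A,\wedge,\vee,\rightarrow,0,1\rangle$ such that $\langle A,\wedge,\vee,0,1\rangle$ is a bounded distributive lattice and for all $a,b,d$: (I1) $(a\to b)\wedge(a\to d)=a\to(b\wedge d)$; (I2) $(a\to d)\wedge(b\to d)=(a\vee b)\to d$; (I3) $0\to a=1$; (I4) $a\to 1=1$. A DLI$^{+}$-algebra additionally satisfies (I5) $a\wedge(a\to b)\le b$. A tense DLI$^{+}$-algebra is $\mathbf{L}=(\mathbf{A},G,H,F,P)$ with $\mathbf{A}$ a DLI$^{+}$-algebra and $G,H,F,P$ unary operations such that for all $x,y$: (T1) $P(x)\le y$ iff $x\le G(y)$; (T2) $F(x)\le y$ iff $x\le H(y)$; (T3) $G(x)\wedge F(y)\le F(x\wedge y)$ and $H(x)\wedge P(y)\le P(x\wedge y)$; (T4) $G(x\vee y)\le G(x)\vee F(y)$ and $H(x\vee y)\le H(x)\vee P(y)$; (T5) $G(x\to y)\le G(x)\to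 G(y)$ and $H(x\to y)\le H(x)\to H(y)$; (T6) $G(x\to y)\le F(x)\to F(y)$ and $H(x\to y)\le P(x)\to P(y)$. $\mathsf{tDLI}^{+}_{0}$ is the category of tense DLI$^{+}$-algebras with $G(0)=0=H(0)$ and homomorphisms (maps preserving $\wedge,\vee,\to,0,1,G,H,F,P$). A centered Kleene algebra is $\langle T,\wedge,\vee,\sim,c,0,1\rangle$ with $\langle T,\wedge,\vee,0,1\rangle$ a bounded distributive lattice, $\sim\sim x=x$, $\sim(x\vee y)=\sim x\wedge\sim y$, $x\wedge\sim x\le y\vee\sim y$, and $\sim c=c$. A KI-algebra is $\langle T,\wedge,\vee,\Rightarrow,\sim,c,0,1\rangle$ with centered Kleene reduct such that (KI1) $\langle T,\vee,\wedge,\Rightarrow,0,1\rangle$ is a DLI-algebra; (KI2) $(x\wedge(x\Rightarrow y))\vee c\le y\vee c$; (KI3) $c\Rightarrow c=1$; (KI4) $(x\Rightarrow y)\wedge c=(\sim x\vee y)\wedge c$; (KI5) $(x\Rightarrow\sim y)\vee c=(x\Rightarrow(\sim y\vee c))\wedge(y\Rightarrow(\sim x\vee c))$. A tense KI-algebra is $(\mathbf{T},G,H)$, $\mathbf{T}$ a KI-algebra, $G,H$ unary, with $F(x):=\sim G(\sim x)$, $P(x):=\sim H(\sim x)$, such that (t1) $G(1)=H(1)=1$; (t2) $G(x\wedge y)=G(x)\wedge G(y)$, $H(x\wedge y)=H(x)\wedge H(y)$; (t3) $x\le GP(x)$, $x\le HF(x)$; (t4) $G(x\vee y)\le G(x)\vee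 F(y)$, $H(x\vee y)\le H(x)\vee P(y)$; (t5) $G(x\Rightarrow y)\le G(x)\Rightarrow G(y)$, $H(x\Rightarrow y)\le H(x)\Rightarrow H(y)$; (t6) $G(x\Rightarrow y)\le F(x)\Rightarrow F(y)$, $H(x\Rightarrow y)\le P(x)\Rightarrow P(y)$. It is centered if $G(c)=c=H(c)$. Condition (CK): for all $x,y\in T$ with $x,y\ge c$ and $x\wedge y\le c$ there is $z\in T$ with $z\vee c=x$ and $\sim z\vee c=y$. $\mathsf{itKI}_{c}$ is the category of tense centered KI-algebras satisfying (CK), with homomorphisms (preserving $\wedge,\vee,\Rightarrow,\sim,c,0,1,G,H$). Functor K: for $\mathbf{L}\in\mathsf{tDLI}^{+}_{0}$, $K(A)=\{(a,b)\in A\times A: a\wedge b=0\}$ with $(a,b)\vee(x,y)=(a\vee x,b\wedge y)$, $(a,b)\wedge(x,y)=(a\wedge x,b\vee y)$, $(a,b)\Rightarrow(x,y)=((a\to x)\wedge(y\to b),a\wedge y)$, $\sim(a,b)=(b,a)$, $0=(0,1)$, $1=(1,0)$, $c=(0,0)$, $G_K(a,b)=(G(a),F(b))$, $H_K(a,b)=(H(a),P(b))$; $\mathrm{K}(\mathbf{L})=(K(A),\dots,G_K,H_K)$ and $\mathrm{K}(f)(x,y)=(f(x),f(y))$. Functor C: for a tense centered KI-algebra $\mathbf{U}=(\mathbf{T},G,H)$, $C(T)=\{x\in T:x\ge c\}$ and $\mathrm{C}(\mathbf{U})=(C(T),\wedge,\vee,\Rightarrow,c,1,G,H,F,P)$ with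 all operations restricted ($c$ the bottom); $\mathrm{C}(f)$ is the restriction of $f$. -}

module Defs where

open import Level using (Level; _⊔_) renaming (suc to lsuc)
open import Data.Product using (Σ; _×_; _,_; proj₁; proj₂)
open import Function using (id; _∘_; _⇔_)
open import Function.Bundles using (Equivalence)
open import Relation.Binary.PropositionalEquality
  using (_≡_; refl; sym; trans; cong; cong₂; subst; module ≡-Reasoning)
open import Algebra.Core using (Op₁; Op₂)
import Algebra.Lattice.Structures as LS

private
  variable
    a : Level

IsDistributiveLattice : {A : Set a} → Op₂ A → Op₂ A → Set a
IsDistributiveLattice = LS.IsDistributiveLattice _≡_

uip : {A : Set a} {x y : A} (p q : x ≡ y) → p ≡ q
uip refl refl = refl

Σ≡-eq : {A B : Set a} (f : A → B) (v : B) {x y : A} {p : f x ≡ v} {q : f y ≡ v}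
      → x ≡ y → _≡_ {A = Σ A (λ u → f u ≡ v)} (x , p) (y , q)
Σ≡-eq f v refl = cong (_ ,_) (uip _ _)

module LatticeFacts {A : Set a} (_∨_ _∧_ : Op₂ A) (𝟘 𝟙 : A)
  (dl : IsDistributiveLattice _∨_ _∧_)
  (top : ∀ x → x ∧ 𝟙 ≡ x) (bot : ∀ x → x ∨ 𝟘 ≡ x) where
  open LS.IsDistributiveLattice dl hiding (refl; sym; trans)

  _≤_ : A → A → Set a
  x ≤ y = x ∧ y ≡ x

  ∧-idem : ∀ x → x ∧ x ≡ x
  ∧-idem x = trans (cong (x ∧_) (sym (∨-absorbs-∧ x x))) (∧-absorbs-∨ x (x ∧ x))

  ∨-idem : ∀ x → x ∨ x ≡ x
  ∨-idem x = trans (cong (x ∨_) (sym (∧-absorbs-∨ x x))) (∨-absorbs-∧ x (x ∨ x))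

  ∧-zeroˡ : ∀ x → 𝟘 ∧ x ≡ 𝟘
  ∧-zeroˡ x = trans (cong (𝟘 ∧_) (sym (trans (∨-comm 𝟘 x) (bot x)))) (∧-absorbs-∨ 𝟘 x)

  ∧-zeroʳ : ∀ x → x ∧ 𝟘 ≡ 𝟘
  ∧-zeroʳ x = trans (∧-comm x 𝟘) (∧-zeroˡ x)

  bot≤ : ∀ x → 𝟘 ≤ x
  bot≤ = ∧-zeroˡ

  ≤𝟘 : ∀ {x} → x ≤ 𝟘 → x ≡ 𝟘
  ≤𝟘 {x} p = trans (sym p) (∧-zeroʳ x)

  ≤-trans : ∀ {x y z} → x ≤ y → y ≤ z → x ≤ z
  ≤-trans {x} {y} {z} p q =
    trans (cong (_∧ z) (sym p))
      (trans (∧-assoc x y z) (trans (cong (x ∧_) q) p))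

  glb : ∀ {x y z} → z ≤ x → z ≤ y → z ≤ (x ∧ y)
  glb {x} {y} {z} p q =
    trans (sym (∧-assoc z x y)) (trans (cong (_∧ y) p) q)

  lb₁ : ∀ x y → (x ∧ y) ≤ x
  lb₁ x y = trans (cong (_∧ x) (∧-comm x y))
    (trans (∧-assoc y x x) (trans (cong (y ∧_) (∧-idem x)) (∧-comm y x)))

  lb₂ : ∀ x y → (x ∧ y) ≤ y
  lb₂ x y = trans (∧-assoc x y y) (cong (x ∧_) (∧-idem y))

  ≤⇒∨ : ∀ {x y} → x ≤ y → x ∨ y ≡ y
  ≤⇒∨ {x} {y} p = trans (cong (_∨ y) (sym p))
    (trans (∨-comm (x ∧ y) y) (trans (cong (y ∨_) (∧-comm x y)) (∨-absorbs-∧ y x)))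

  ub : ∀ {z x} y → z ≤ x → z ≤ (x ∨ y)
  ub {z} {x} y p = trans (∧-distribˡ-∨ z x y)
    (trans (cong (_∨ (z ∧ y)) p) (∨-absorbs-∧ z y))

-- Tense DLI⁺-algebras with G(0)=0=H(0)   (category tDLI⁺₀)

record TDLIOps (A : Set a) : Set a where
  infixr 7 _∧_
  infixr 6 _∨_
  infixr 5 _⇒_
  infix 4 _≤_
  field
    _∧_ _∨_ _⇒_ : Op₂ A
    𝟘 𝟙 : A
    G H F P : Op₁ A
  _≤_ : A → A → Set a
  x ≤ y = x ∧ y ≡ x

record IsTDLI0 {A : Set a} (o : TDLIOps A) : Set a where
  open TDLIOps o
  field
    isDistLat : IsDistributiveLattice _∨_ _∧_
    𝟙-top : ∀ x → x ∧ 𝟙 ≡ x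
    𝟘-bot : ∀ x → x ∨ 𝟘 ≡ x
    I1 : ∀ x y z → (x ⇒ y) ∧ (x ⇒ z) ≡ x ⇒ (y ∧ z)
    I2 : ∀ x y z → (x ⇒ z) ∧ (y ⇒ z) ≡ (x ∨ y) ⇒ z
    I3 : ∀ x → 𝟘 ⇒ x ≡ 𝟙
    I4 : ∀ x → x ⇒ 𝟙 ≡ 𝟙
    I5 : ∀ x y → x ∧ (x ⇒ y) ≤ y
    T1 : ∀ x y → (P x ≤ y) ⇔ (x ≤ G y)
    T2 : ∀ x y → (F x ≤ y) ⇔ (x ≤ H y)
    T3G : ∀ x y → G x ∧ F y ≤ F (x ∧ y)
    T3H : ∀ x y → H x ∧ P y ≤ P (x ∧ y)
    T4G : ∀ x y → G (x ∨ y) ≤ G x ∨ F y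
    T4H : ∀ x y → H (x ∨ y) ≤ H x ∨ P y
    T5G : ∀ x y → G (x ⇒ y) ≤ G x ⇒ G y
    T5H : ∀ x y → H (x ⇒ y) ≤ H x ⇒ H y
    T6G : ∀ x y → G (x ⇒ y) ≤ F x ⇒ F y
    T6H : ∀ x y → H (x ⇒ y) ≤ P x ⇒ P y
    G𝟘 : G 𝟘 ≡ 𝟘
    H𝟘 : H 𝟘 ≡ 𝟘

record TDLI0 (a : Level) : Set (lsuc a) where
  field
    Carrier : Set a
    ops     : TDLIOps Carrier
    laws    : IsTDLI0 ops

record IsTDLIHom {A B : Set a} (o : TDLIOps A) (o' : TDLIOps B) (f : A → B) : Set a where
  private
    module O = TDLIOps o
    module O' = TDLIOps o'
  field
    hom-∧ : ∀ x y → f (x O.∧ y) ≡ f x O'.∧ f y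
    hom-∨ : ∀ x y → f (x O.∨ y) ≡ f x O'.∨ f y
    hom-⇒ : ∀ x y → f (x O.⇒ y) ≡ f x O'.⇒ f y
    hom-𝟘 : f O.𝟘 ≡ O'.𝟘
    hom-𝟙 : f O.𝟙 ≡ O'.𝟙
    hom-G : ∀ x → f (O.G x) ≡ O'.G (f x)
    hom-H : ∀ x → f (O.H x) ≡ O'.H (f x)
    hom-F : ∀ x → f (O.F x) ≡ O'.F (f x)
    hom-P : ∀ x → f (O.P x) ≡ O'.P (f x)

record IsTDLIIso {A B : Set a} (o : TDLIOps A) (o' : TDLIOps B) (f : A → B) : Set a where
  field
    hom     : IsTDLIHom o o' f
    inv     : B → A
    inv-hom : IsTDLIHom o' o inv
    invˡ    : ∀ x → inv (f x) ≡ x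
    invʳ    : ∀ y → f (inv y) ≡ y

-- Tense centered KI-algebras satisfying (CK)   (category itKI_c)

record KIOps (T : Set a) : Set a where
  infixr 7 _∧_
  infixr 6 _∨_
  infixr 5 _⇒_
  infix 4 _≤_
  field
    _∧_ _∨_ _⇒_ : Op₂ T
    ∼ : Op₁ T
    c 𝟘 𝟙 : T
    G H : Op₁ T
  _≤_ : T → T → Set a
  x ≤ y = x ∧ y ≡ x
  F : Op₁ T
  F x = ∼ (G (∼ x))
  P : Op₁ T
  P x = ∼ (H (∼ x))

record IsItKIc {T : Set a} (o : KIOps T) : Set a where
  open KIOps o
  field
    isDistLat : IsDistributiveLattice _∨_ _∧_
    𝟙-top : ∀ x → x ∧ 𝟙 ≡ x
    𝟘-bot : ∀ x → x ∨ 𝟘 ≡ x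
    ∼∼ : ∀ x → ∼ (∼ x) ≡ x
    ∼-∨ : ∀ x y → ∼ (x ∨ y) ≡ ∼ x ∧ ∼ y
    kleene : ∀ x y → x ∧ ∼ x ≤ y ∨ ∼ y
    ∼c : ∼ c ≡ c
    I1 : ∀ x y z → (x ⇒ y) ∧ (x ⇒ z) ≡ x ⇒ (y ∧ z)
    I2 : ∀ x y z → (x ⇒ z) ∧ (y ⇒ z) ≡ (x ∨ y) ⇒ z
    I3 : ∀ x → 𝟘 ⇒ x ≡ 𝟙
    I4 : ∀ x → x ⇒ 𝟙 ≡ 𝟙
    KI2 : ∀ x y → (x ∧ (x ⇒ y)) ∨ c ≤ y ∨ c
    KI3 : c ⇒ c ≡ 𝟙
    KI4 : ∀ x y → (x ⇒ y) ∧ c ≡ (∼ x ∨ y) ∧ c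
    KI5 : ∀ x y → (x ⇒ ∼ y) ∨ c ≡ (x ⇒ (∼ y ∨ c)) ∧ (y ⇒ (∼ x ∨ c))
    t1G : G 𝟙 ≡ 𝟙
    t1H : H 𝟙 ≡ 𝟙
    t2G : ∀ x y → G (x ∧ y) ≡ G x ∧ G y
    t2H : ∀ x y → H (x ∧ y) ≡ H x ∧ H y
    t3G : ∀ x → x ≤ G (P x)
    t3H : ∀ x → x ≤ H (F x)
    t4G : ∀ x y → G (x ∨ y) ≤ G x ∨ F y
    t4H : ∀ x y → H (x ∨ y) ≤ H x ∨ P y
    t5G : ∀ x y → G (x ⇒ y) ≤ G x ⇒ G y
    t5H : ∀ x y → H (x ⇒ y) ≤ H x ⇒ H y
    t6G : ∀ x y → G (x ⇒ y) ≤ F x ⇒ F y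
    t6H : ∀ x y → H (x ⇒ y) ≤ P x ⇒ P y
    Gc : G c ≡ c
    Hc : H c ≡ c
    CK : ∀ x y → c ≤ x → c ≤ y → x ∧ y ≤ c
       → Σ T (λ z → (z ∨ c ≡ x) × (∼ z ∨ c ≡ y))

record ItKIc (a : Level) : Set (lsuc a) where
  field
    Carrier : Set a
    ops     : KIOps Carrier
    laws    : IsItKIc ops

record IsKIHom {A B : Set a} (o : KIOps A) (o' : KIOps B) (f : A → B) : Set a where
  private
    module O = KIOps o
    module O' = KIOps o'
  field
    hom-∧ : ∀ x y → f (x O.∧ y) ≡ f x O'.∧ f y
    hom-∨ : ∀ x y → f (x O.∨ y) ≡ f x O'.∨ f y
    hom-⇒ : ∀ x y → f (x O.⇒ y) ≡ f x O'.⇒ f y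
    hom-∼ : ∀ x → f (O.∼ x) ≡ O'.∼ (f x)
    hom-c : f O.c ≡ O'.c
    hom-𝟘 : f O.𝟘 ≡ O'.𝟘
    hom-𝟙 : f O.𝟙 ≡ O'.𝟙
    hom-G : ∀ x → f (O.G x) ≡ O'.G (f x)
    hom-H : ∀ x → f (O.H x) ≡ O'.H (f x)

record IsKIIso {A B : Set a} (o : KIOps A) (o' : KIOps B) (f : A → B) : Set a where
  field
    hom     : IsKIHom o o' f
    inv     : B → A
    inv-hom : IsKIHom o' o inv
    invˡ    : ∀ x → inv (f x) ≡ x
    invʳ    : ∀ y → f (inv y) ≡ y

KCar : {A : Set a} → TDLIOps A → Set a
KCar {A = A} o = Σ (A × A) (λ ab → proj₁ ab ∧ proj₂ ab ≡ 𝟘)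
  where open TDLIOps o

module KConstruction {A : Set a} (o : TDLIOps A) (l : IsTDLI0 o) where
  open TDLIOps o
  open IsTDLI0 l
  open LS.IsDistributiveLattice isDistLat hiding (refl; sym; trans)
  open LatticeFacts _∨_ _∧_ 𝟘 𝟙 isDistLat 𝟙-top 𝟘-bot
    using (∧-zeroˡ; ∧-zeroʳ; bot≤; ≤𝟘; ≤-trans; glb; lb₁; lb₂)

  private
    ∨-cl : ∀ {p q r s} → p ∧ q ≡ 𝟘 → r ∧ s ≡ 𝟘 → (p ∨ r) ∧ (q ∧ s) ≡ 𝟘
    ∨-cl {p} {q} {r} {s} e₁ e₂ =
      trans (∧-distribʳ-∨ (q ∧ s) p r)
        (trans (cong₂ _∨_
          (trans (sym (∧-assoc p q s)) (trans (cong (_∧ s) e₁) (∧-zeroˡ s)))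
          (trans (cong (r ∧_) (∧-comm q s))
            (trans (sym (∧-assoc r s q)) (trans (cong (_∧ q) e₂) (∧-zeroˡ q)))))
          (𝟘-bot 𝟘))

    ∧-cl : ∀ {p q r s} → p ∧ q ≡ 𝟘 → r ∧ s ≡ 𝟘 → (p ∧ r) ∧ (q ∨ s) ≡ 𝟘
    ∧-cl {p} {q} {r} {s} e₁ e₂ =
      trans (∧-distribˡ-∨ (p ∧ r) q s)
        (trans (cong₂ _∨_
          (trans (cong (_∧ q) (∧-comm p r))
            (trans (∧-assoc r p q) (trans (cong (r ∧_) e₁) (∧-zeroʳ r))))
          (trans (∧-assoc p r s) (trans (cong (p ∧_) e₂) (∧-zeroʳ p))))
          (𝟘-bot 𝟘))

    ⇒-cl : ∀ {p q r s} → p ∧ q ≡ 𝟘 → r ∧ s ≡ 𝟘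
         → ((p ⇒ r) ∧ (s ⇒ q)) ∧ (p ∧ s) ≡ 𝟘
    ⇒-cl {p} {q} {r} {s} e₁ e₂ = ≤𝟘 (subst (w ≤_) e₁ (glb w≤p w≤q))
      where
        w = ((p ⇒ r) ∧ (s ⇒ q)) ∧ (p ∧ s)
        w≤p : w ≤ p
        w≤p = ≤-trans (lb₂ _ _) (lb₁ p s)
        w≤q : w ≤ q
        w≤q = ≤-trans (glb (≤-trans (lb₂ _ _) (lb₂ p s))
                           (≤-trans (lb₁ _ _) (lb₂ (p ⇒ r) (s ⇒ q))))
                      (I5 s q)

    F𝟘 : F 𝟘 ≡ 𝟘
    F𝟘 = ≤𝟘 (Equivalence.from (T2 𝟘 𝟘) (bot≤ (H 𝟘)))

    P𝟘 : P 𝟘 ≡ 𝟘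
    P𝟘 = ≤𝟘 (Equivalence.from (T1 𝟘 𝟘) (bot≤ (G 𝟘)))

    G-cl : ∀ {p q} → p ∧ q ≡ 𝟘 → G p ∧ F q ≡ 𝟘
    G-cl {p} {q} e = ≤𝟘 (subst (G p ∧ F q ≤_) F𝟘 (subst (λ u → G p ∧ F q ≤ F u) e (T3G p q)))

    H-cl : ∀ {p q} → p ∧ q ≡ 𝟘 → H p ∧ P q ≡ 𝟘
    H-cl {p} {q} e = ≤𝟘 (subst (H p ∧ P q ≤_) P𝟘 (subst (λ u → H p ∧ P q ≤ P u) e (T3H p q)))

  Kops : KIOps (KCar o)
  Kops = record
    { _∧_ = λ { ((p , q) , e₁) ((r , s) , e₂) → (p ∧ r , q ∨ s) , ∧-cl e₁ e₂ }
    ; _∨_ = λ { ((p , q) , e₁) ((r , s) , e₂) → (p ∨ r , q ∧ s) , ∨-cl e₁ e₂ }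
    ; _⇒_ = λ { ((p , q) , e₁) ((r , s) , e₂) → ((p ⇒ r) ∧ (s ⇒ q) , p ∧ s) , ⇒-cl e₁ e₂ }
    ; ∼   = λ { ((p , q) , e) → (q , p) , trans (∧-comm q p) e }
    ; c   = (𝟘 , 𝟘) , ∧-zeroˡ 𝟘
    ; 𝟘   = (𝟘 , 𝟙) , ∧-zeroˡ 𝟙
    ; 𝟙   = (𝟙 , 𝟘) , ∧-zeroʳ 𝟙
    ; G   = λ { ((p , q) , e) → (G p , F q) , G-cl e }
    ; H   = λ { ((p , q) , e) → (H p , P q) , H-cl e }
    }

Kops : {A : Set a} (o : TDLIOps A) → IsTDLI0 o → KIOps (KCar o)
Kops o l = KConstruction.Kops o l

Kmap : {A B : Set a} {o : TDLIOps A} {o' : TDLIOps B}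
       (f : A → B) → IsTDLIHom o o' f → KCar o → KCar o'
Kmap {o = o} {o' = o'} f h ((x , y) , e) =
  (f x , f y) , trans (sym (hom-∧ x y)) (trans (cong f e) hom-𝟘)
  where open IsTDLIHom h

KOpsOf : (L : TDLI0 a) → KIOps (KCar (TDLI0.ops L))
KOpsOf L = Kops (TDLI0.ops L) (TDLI0.laws L)

KObj : (L : TDLI0 a) → IsItKIc (KOpsOf L) → ItKIc a
KObj L p = record { Carrier = KCar (TDLI0.ops L) ; ops = KOpsOf L ; laws = p }

CCar : {T : Set a} → KIOps T → Set a
CCar {T = T} o = Σ T (λ x → c ∧ x ≡ c)
  where open KIOps o

module CConstruction {T : Set a} (o : KIOps T) (l : IsItKIc o) where
  open KIOps o
  open IsItKIc l
  open LS.IsDistributiveLattice isDistLat hiding (refl; sym; trans)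
  open LatticeFacts _∨_ _∧_ 𝟘 𝟙 isDistLat 𝟙-top 𝟘-bot
    using (∧-idem; ≤-trans; glb; ub; ≤⇒∨)

  private
    G-mono : ∀ {x y} → x ≤ y → G x ≤ G y
    G-mono {x} {y} p = trans (sym (t2G x y)) (cong G p)

    H-mono : ∀ {x y} → x ≤ y → H x ≤ H y
    H-mono {x} {y} p = trans (sym (t2H x y)) (cong H p)

    ∼-anti : ∀ {x y} → x ≤ y → ∼ y ≤ ∼ x
    ∼-anti {x} {y} p = trans (∧-comm (∼ y) (∼ x)) (trans (sym (∼-∨ x y)) (cong ∼ (≤⇒∨ p)))

    ∼-cl : ∀ {x} → c ≤ x → ∼ x ≤ c
    ∼-cl p = subst (_ ≤_) ∼c (∼-anti p)

    ∼-cl' : ∀ {x} → x ≤ c → c ≤ ∼ x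
    ∼-cl' p = subst (_≤ _) ∼c (∼-anti p)

    ⇒-cl : ∀ {x y} → c ≤ y → c ≤ (x ⇒ y)
    ⇒-cl {x} {y} p =
      trans (∧-comm c (x ⇒ y)) (trans (KI4 x y)
        (trans (∧-comm (∼ x ∨ y) c)
          (trans (cong (c ∧_) (∨-comm (∼ x) y)) (ub (∼ x) p))))

    G-cl : ∀ {x} → c ≤ x → c ≤ G x
    G-cl p = subst (_≤ _) Gc (G-mono p)

    H-cl : ∀ {x} → c ≤ x → c ≤ H x
    H-cl p = subst (_≤ _) Hc (H-mono p)

    F-cl : ∀ {x} → c ≤ x → c ≤ F x
    F-cl p = ∼-cl' (subst (_ ≤_) Gc (G-mono (∼-cl p)))

    P-cl : ∀ {x} → c ≤ x → c ≤ P x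
    P-cl p = ∼-cl' (subst (_ ≤_) Hc (H-mono (∼-cl p)))

  Cops : TDLIOps (CCar o)
  Cops = record
    { _∧_ = λ { (x , p) (y , q) → x ∧ y , glb p q }
    ; _∨_ = λ { (x , p) (y , q) → x ∨ y , ub y p }
    ; _⇒_ = λ { (x , p) (y , q) → x ⇒ y , ⇒-cl q }
    ; 𝟘   = c , ∧-idem c
    ; 𝟙   = 𝟙 , 𝟙-top c
    ; G   = λ { (x , p) → G x , G-cl p }
    ; H   = λ { (x , p) → H x , H-cl p }
    ; F   = λ { (x , p) → F x , F-cl p }
    ; P   = λ { (x , p) → P x , P-cl p }
    }

Cops : {T : Set a} (o : KIOps T) → IsItKIc o → TDLIOps (CCar o)
Cops o l = CConstruction.Cops o l

Cmap : {A B : Set a} {o : KIOps A} {o' : KIOps B}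
       (g : A → B) → IsKIHom o o' g → CCar o → CCar o'
Cmap {o = o} {o' = o'} g h (x , e) =
  g x , trans (cong (λ u → KIOps._∧_ o' u (g x)) (sym hom-c))
          (trans (sym (hom-∧ (KIOps.c o) x)) (trans (cong g e) hom-c))
  where open IsKIHom h

COpsOf : (U : ItKIc a) → TDLIOps (CCar (ItKIc.ops U))
COpsOf U = Cops (ItKIc.ops U) (ItKIc.laws U)

CObj : (U : ItKIc a) → IsTDLI0 (COpsOf U) → TDLI0 a
CObj U p = record { Carrier = CCar (ItKIc.ops U) ; ops = COpsOf U ; laws = p }

α : (L : TDLI0 a) → TDLI0.Carrier L → CCar (KOpsOf L)
α L x = ((x , 𝟘) , ∧-zeroʳ x) , Σ≡-eq _ _ (cong₂ _,_ (∧-zeroˡ x) (𝟘-bot 𝟘))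
  where
    open TDLIOps (TDLI0.ops L)
    open IsTDLI0 (TDLI0.laws L)
    open LatticeFacts _∨_ _∧_ 𝟘 𝟙 isDistLat 𝟙-top 𝟘-bot using (∧-zeroˡ; ∧-zeroʳ)

β : (U : ItKIc a) → ItKIc.Carrier U → KCar (COpsOf U)
β U x = ((x ∨ c , p₁) , (∼ x ∨ c , p₂)) , Σ≡-eq _ _ q
  where
    open KIOps (ItKIc.ops U)
    open IsItKIc (ItKIc.laws U)
    open LS.IsDistributiveLattice isDistLat hiding (refl; sym; trans)
    open LatticeFacts _∨_ _∧_ 𝟘 𝟙 isDistLat 𝟙-top 𝟘-bot using (∨-idem; ≤⇒∨)
    p₁ : c ∧ (x ∨ c) ≡ c
    p₁ = trans (cong (c ∧_) (∨-comm x c)) (∧-absorbs-∨ c x)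
    p₂ : c ∧ (∼ x ∨ c) ≡ c
    p₂ = trans (cong (c ∧_) (∨-comm (∼ x) c)) (∧-absorbs-∨ c (∼ x))
    q : (x ∨ c) ∧ (∼ x ∨ c) ≡ c
    q = trans (sym (∨-distribʳ-∧ c x (∼ x)))
          (≤⇒∨ (subst (x ∧ ∼ x ≤_) (trans (cong (c ∨_) ∼c) (∨-idem c)) (kleene x c)))

record KCEquivalence (a : Level) : Set (lsuc a) where
  open TDLI0
  open ItKIc
  field
    K-obj  : (L : TDLI0 a) → IsItKIc (KOpsOf L)
    K-hom  : (L M : TDLI0 a) (f : Carrier L → Carrier M) (hf : IsTDLIHom (ops L) (ops M) f)
           → IsKIHom (KOpsOf L) (KOpsOf M) (Kmap f hf)
    K-id   : (L : TDLI0 a) (h : IsTDLIHom (ops L) (ops L) id)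
           → ∀ x → Kmap id h x ≡ x
    K-comp : (L M N : TDLI0 a) (f : Carrier L → Carrier M) (g : Carrier M → Carrier N)
             (hf : IsTDLIHom (ops L) (ops M) f) (hg : IsTDLIHom (ops M) (ops N) g)
             (hgf : IsTDLIHom (ops L) (ops N) (g ∘ f))
           → ∀ x → Kmap (g ∘ f) hgf x ≡ Kmap g hg (Kmap f hf x)
    C-obj  : (U : ItKIc a) → IsTDLI0 (COpsOf U)
    C-hom  : (U V : ItKIc a) (g : Carrier U → Carrier V) (hg : IsKIHom (ops U) (ops V) g)
           → IsTDLIHom (COpsOf U) (COpsOf V) (Cmap g hg)
    C-id   : (U : ItKIc a) (h : IsKIHom (ops U) (ops U) id)
           → ∀ x → Cmap id h x ≡ x
    C-comp : (U V W : ItKIc a) (f : Carrier U → Carrier V) (g : Carrier V → Carrier W)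
             (hf : IsKIHom (ops U) (ops V) f) (hg : IsKIHom (ops V) (ops W) g)
             (hgf : IsKIHom (ops U) (ops W) (g ∘ f))
           → ∀ x → Cmap (g ∘ f) hgf x ≡ Cmap g hg (Cmap f hf x)
    α-iso  : (L : TDLI0 a) → IsTDLIIso (ops L) (COpsOf (KObj L (K-obj L))) (α L)
    α-nat  : (L M : TDLI0 a) (f : Carrier L → Carrier M) (hf : IsTDLIHom (ops L) (ops M) f)
           → ∀ x → Cmap (Kmap f hf) (K-hom L M f hf) (α L x) ≡ α M (f x)
    β-iso  : (U : ItKIc a) → IsKIIso (ops U) (KOpsOf (CObj U (C-obj U))) (β U)
    β-nat  : (U V : ItKIc a) (g : Carrier U → Carrier V) (hg : IsKIHom (ops U) (ops V) g)
           → ∀ x → Kmap (Cmap g hg) (C-hom U V g hg) (β U x) ≡ β V (g x)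

module Submission where

open import Level using (Level)
open import Defs
open import Data.Product using (Σ; _×_; _,_; proj₁; proj₂)
open import Function using (_∘_; _⇔_; mk⇔)
open import Function.Bundles using (Equivalence)
open import Relation.Binary.PropositionalEquality
  using (_≡_; refl; sym; trans; cong; cong₂; subst; subst₂; isEquivalence; module ≡-Reasoning)
open import Algebra.Core using (Op₁; Op₂)
import Algebra.Lattice.Structures as LS

-- K(L) is the set of disjoint pairs (a, b) of L, ordered as L × Lᵒᵖ, with ∼ the swap and
-- c = (0, 0). Each axiom of a tense centered KI-algebra splits into one axiom of L per
-- component, G acting as G on the first and as its conjugate F on the second; the
-- residuations P ⊣ G and F ⊣ H make G preserve meets and F joins. Conversely, in a
-- centered KI-algebra the residuations come from (t2), (t3) and the involution, so C(U) is
-- a tense DLI⁺-algebra. Since ∼(x ∧ c) = ∼x ∨ c, the pair (x ∨ c, ∼x ∨ c) determines x ∧ c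
-- and x ∨ c, hence x by cancellation in a distributive lattice; (CK) says precisely that
-- every element of K(C(U)) is such a pair, so β is bijective. It preserves ⇒ by (KI4) and
-- (KI5), and G, H because G(x ∨ c) = G x ∨ c. Finally α is inverted by the first
-- projection, because every pair above c in K(L) has second component 0.

private
  variable
    ℓ : Level

module BoundedLatticeOrder {A : Set ℓ} (_∨_ _∧_ : Op₂ A) (𝟘 𝟙 : A)
  (dl : IsDistributiveLattice _∨_ _∧_)
  (top : ∀ x → x ∧ 𝟙 ≡ x) (bot : ∀ x → x ∨ 𝟘 ≡ x) where
  open LS.IsDistributiveLattice dl public hiding (refl; sym; trans; isEquivalence)
  open LatticeFacts _∨_ _∧_ 𝟘 𝟙 dl top bot public
  open Equivalence using (to; from)

  ≤-refl : ∀ {x} → x ≤ x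
  ≤-refl {x} = ∧-idem x

  ≤-antisym : ∀ {x y} → x ≤ y → y ≤ x → x ≡ y
  ≤-antisym {x} {y} p q = trans (sym p) (trans (∧-comm x y) q)

  ≤-respˡ-≡ : ∀ {x y z} → x ≡ y → x ≤ z → y ≤ z
  ≤-respˡ-≡ {z = z} e = subst (_≤ z) e

  ≤-respʳ-≡ : ∀ {x y z} → y ≡ z → x ≤ y → x ≤ z
  ≤-respʳ-≡ {x} e = subst (x ≤_) e

  ∨-least : ∀ {x y z} → x ≤ z → y ≤ z → (x ∨ y) ≤ z
  ∨-least {x} {y} {z} p q = trans (∧-distribʳ-∨ z x y) (cong₂ _∨_ p q)

  x≤x∨y : ∀ x y → x ≤ (x ∨ y)
  x≤x∨y x y = ub y ≤-refl

  y≤x∨y : ∀ x y → y ≤ (x ∨ y)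
  y≤x∨y x y = ≤-respʳ-≡ (∨-comm y x) (x≤x∨y y x)

  ∧-mono-≤ : ∀ {x y u v} → x ≤ u → y ≤ v → (x ∧ y) ≤ (u ∧ v)
  ∧-mono-≤ p q = glb (≤-trans (lb₁ _ _) p) (≤-trans (lb₂ _ _) q)

  ∨-mono-≤ : ∀ {x y u v} → x ≤ u → y ≤ v → (x ∨ y) ≤ (u ∨ v)
  ∨-mono-≤ {u = u} {v} p q = ∨-least (≤-trans p (x≤x∨y u v)) (≤-trans q (y≤x∨y u v))

  ∨-absorbs-≤ : ∀ {x y} → x ≤ y → y ∨ x ≡ y
  ∨-absorbs-≤ {x} {y} p = trans (∨-comm y x) (≤⇒∨ p)

  ≡𝟘⇒≤ : ∀ {z} → z ≡ 𝟘 → ∀ x → z ≤ x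
  ≡𝟘⇒≤ e x = ≤-respˡ-≡ (sym e) (bot≤ x)

  𝟙≤⇒≡𝟙 : ∀ {x} → 𝟙 ≤ x → x ≡ 𝟙
  𝟙≤⇒≡𝟙 {x} p = ≤-antisym (top x) p

  ∨-identityˡ : ∀ x → 𝟘 ∨ x ≡ x
  ∨-identityˡ x = trans (∨-comm 𝟘 x) (bot x)

  ∨-zeroˡ : ∀ x → 𝟙 ∨ x ≡ 𝟙
  ∨-zeroˡ x = trans (∨-comm 𝟙 x) (≤⇒∨ (top x))

  ∨-distribʳ-∨ : ∀ x y z → (x ∨ y) ∨ z ≡ (x ∨ z) ∨ (y ∨ z)
  ∨-distribʳ-∨ x y z = begin
    (x ∨ y) ∨ z         ≡⟨ cong ((x ∨ y) ∨_) (sym (∨-idem z)) ⟩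
    (x ∨ y) ∨ (z ∨ z)   ≡⟨ ∨-assoc x y (z ∨ z) ⟩
    x ∨ (y ∨ (z ∨ z))   ≡⟨ cong (x ∨_) (sym (∨-assoc y z z)) ⟩
    x ∨ ((y ∨ z) ∨ z)   ≡⟨ cong (λ u → x ∨ (u ∨ z)) (∨-comm y z) ⟩
    x ∨ ((z ∨ y) ∨ z)   ≡⟨ cong (x ∨_) (∨-assoc z y z) ⟩
    x ∨ (z ∨ (y ∨ z))   ≡⟨ sym (∨-assoc x z (y ∨ z)) ⟩
    (x ∨ z) ∨ (y ∨ z)   ∎
    where open ≡-Reasoning

  ∧-interchange : ∀ x y z w → (x ∧ y) ∧ (z ∧ w) ≡ (x ∧ z) ∧ (y ∧ w)
  ∧-interchange x y z w = begin
    (x ∧ y) ∧ (z ∧ w)   ≡⟨ ∧-assoc x y (z ∧ w) ⟩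
    x ∧ (y ∧ (z ∧ w))   ≡⟨ cong (x ∧_) (sym (∧-assoc y z w)) ⟩
    x ∧ ((y ∧ z) ∧ w)   ≡⟨ cong (λ u → x ∧ (u ∧ w)) (∧-comm y z) ⟩
    x ∧ ((z ∧ y) ∧ w)   ≡⟨ cong (x ∧_) (∧-assoc z y w) ⟩
    x ∧ (z ∧ (y ∧ w))   ≡⟨ sym (∧-assoc x z (y ∧ w)) ⟩
    (x ∧ z) ∧ (y ∧ w)   ∎
    where open ≡-Reasoning

  ∧-∨-cancelʳ : ∀ {x y z} → x ∧ z ≡ y ∧ z → x ∨ z ≡ y ∨ z → x ≡ y
  ∧-∨-cancelʳ {x} {y} {z} ∧≡ ∨≡ = begin
    x                   ≡⟨ sym (∧-absorbs-∨ x z) ⟩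
    x ∧ (x ∨ z)         ≡⟨ cong (x ∧_) ∨≡ ⟩
    x ∧ (y ∨ z)         ≡⟨ ∧-distribˡ-∨ x y z ⟩
    (x ∧ y) ∨ (x ∧ z)   ≡⟨ cong₂ _∨_ (∧-comm x y) ∧≡ ⟩
    (y ∧ x) ∨ (y ∧ z)   ≡⟨ sym (∧-distribˡ-∨ y x z) ⟩
    y ∧ (x ∨ z)         ≡⟨ cong (y ∧_) ∨≡ ⟩
    y ∧ (y ∨ z)         ≡⟨ ∧-absorbs-∨ y z ⟩
    y                   ∎
    where open ≡-Reasoning

  module GaloisConnection (l r : Op₁ A) (l⊣r : ∀ x y → (l x ≤ y) ⇔ (x ≤ r y)) where

    unit : ∀ x → x ≤ r (l x)
    unit x = to (l⊣r x (l x)) ≤-refl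

    counit : ∀ y → l (r y) ≤ y
    counit y = from (l⊣r (r y) y) ≤-refl

    l-mono : ∀ {x y} → x ≤ y → l x ≤ l y
    l-mono {x} {y} p = from (l⊣r x (l y)) (≤-trans p (unit y))

    r-mono : ∀ {x y} → x ≤ y → r x ≤ r y
    r-mono {x} {y} p = to (l⊣r (r x) y) (≤-trans (counit x) p)

    r-∧ : ∀ x y → r (x ∧ y) ≡ r x ∧ r y
    r-∧ x y = ≤-antisym (glb (r-mono (lb₁ x y)) (r-mono (lb₂ x y)))
      (to (l⊣r _ _) (glb (≤-trans (l-mono (lb₁ _ _)) (counit x))
                         (≤-trans (l-mono (lb₂ _ _)) (counit y))))

    l-∨ : ∀ x y → l (x ∨ y) ≡ l x ∨ l y
    l-∨ x y = ≤-antisym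
      (from (l⊣r _ _) (∨-least (to (l⊣r x _) (x≤x∨y _ _)) (to (l⊣r y _) (y≤x∨y _ _))))
      (∨-least (l-mono (x≤x∨y x y)) (l-mono (y≤x∨y x y)))

    r-𝟙 : r 𝟙 ≡ 𝟙
    r-𝟙 = 𝟙≤⇒≡𝟙 (to (l⊣r 𝟙 𝟙) (top _))

    l-𝟘 : l 𝟘 ≡ 𝟘
    l-𝟘 = ≤𝟘 (from (l⊣r 𝟘 𝟘) (bot≤ (r 𝟘)))

  module Involution (∼ : Op₁ A) (∼∼ : ∀ x → ∼ (∼ x) ≡ x)
                    (∼-∨ : ∀ x y → ∼ (x ∨ y) ≡ ∼ x ∧ ∼ y) where

    ∼-antitone : ∀ {x y} → x ≤ y → ∼ y ≤ ∼ x
    ∼-antitone {x} {y} p = trans (∧-comm (∼ y) (∼ x)) (trans (sym (∼-∨ x y)) (cong ∼ (≤⇒∨ p)))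

    ∼-∧ : ∀ x y → ∼ (x ∧ y) ≡ ∼ x ∨ ∼ y
    ∼-∧ x y = begin
      ∼ (x ∧ y)               ≡⟨ cong ∼ (cong₂ _∧_ (sym (∼∼ x)) (sym (∼∼ y))) ⟩
      ∼ (∼ (∼ x) ∧ ∼ (∼ y))   ≡⟨ cong ∼ (sym (∼-∨ (∼ x) (∼ y))) ⟩
      ∼ (∼ (∼ x ∨ ∼ y))       ≡⟨ ∼∼ _ ⟩
      ∼ x ∨ ∼ y               ∎
      where open ≡-Reasoning

    ∼-𝟘 : ∼ 𝟘 ≡ 𝟙
    ∼-𝟘 = 𝟙≤⇒≡𝟙 (≤-respˡ-≡ (∼∼ 𝟙) (∼-antitone (bot≤ (∼ 𝟙))))

    ∼-𝟙 : ∼ 𝟙 ≡ 𝟘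
    ∼-𝟙 = trans (cong ∼ (sym ∼-𝟘)) (∼∼ 𝟘)

KCar-≡ : {A : Set ℓ} (o : TDLIOps A) {p q r s : A}
         {e : TDLIOps._∧_ o p q ≡ TDLIOps.𝟘 o} {e′ : TDLIOps._∧_ o r s ≡ TDLIOps.𝟘 o}
       → p ≡ r → q ≡ s → _≡_ {A = KCar o} ((p , q) , e) ((r , s) , e′)
KCar-≡ o p≡r q≡s =
  Σ≡-eq (λ ab → TDLIOps._∧_ o (proj₁ ab) (proj₂ ab)) (TDLIOps.𝟘 o) (cong₂ _,_ p≡r q≡s)

CCar-≡ : {T : Set ℓ} (o : KIOps T) {x y : T}
         {p : KIOps._∧_ o (KIOps.c o) x ≡ KIOps.c o} {q : KIOps._∧_ o (KIOps.c o) y ≡ KIOps.c o}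
       → x ≡ y → _≡_ {A = CCar o} (x , p) (y , q)
CCar-≡ o = Σ≡-eq (λ u → KIOps._∧_ o (KIOps.c o) u) (KIOps.c o)

module _ {A B : Set ℓ} {f : A → B} {g : B → A}
         (g∘f≗id : ∀ x → g (f x) ≡ x) (f∘g≗id : ∀ y → f (g y) ≡ y) where

  inverse-preserves₀ : ∀ {u v} → f u ≡ v → g v ≡ u
  inverse-preserves₀ {u} f[u]≡v = trans (cong g (sym f[u]≡v)) (g∘f≗id u)

  inverse-preserves₁ : {opᴬ : Op₁ A} {opᴮ : Op₁ B}
                     → (∀ x → f (opᴬ x) ≡ opᴮ (f x)) → ∀ y → g (opᴮ y) ≡ opᴬ (g y)
  inverse-preserves₁ {opᴮ = opᴮ} hom y =
    inverse-preserves₀ (trans (hom (g y)) (cong opᴮ (f∘g≗id y)))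

  inverse-preserves₂ : {opᴬ : Op₂ A} {opᴮ : Op₂ B}
                     → (∀ x y → f (opᴬ x y) ≡ opᴮ (f x) (f y))
                     → ∀ x y → g (opᴮ x y) ≡ opᴬ (g x) (g y)
  inverse-preserves₂ {opᴮ = opᴮ} hom x y =
    inverse-preserves₀ (trans (hom (g x) (g y)) (cong₂ opᴮ (f∘g≗id x) (f∘g≗id y)))

  isTDLIIso : {o : TDLIOps A} {o′ : TDLIOps B} → IsTDLIHom o o′ f → IsTDLIIso o o′ f
  isTDLIIso h = record
    { hom = h ; inv = g ; invˡ = g∘f≗id ; invʳ = f∘g≗id
    ; inv-hom = record
      { hom-∧ = inverse-preserves₂ hom-∧ ; hom-∨ = inverse-preserves₂ hom-∨
      ; hom-⇒ = inverse-preserves₂ hom-⇒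
      ; hom-𝟘 = inverse-preserves₀ hom-𝟘 ; hom-𝟙 = inverse-preserves₀ hom-𝟙
      ; hom-G = inverse-preserves₁ hom-G ; hom-H = inverse-preserves₁ hom-H
      ; hom-F = inverse-preserves₁ hom-F ; hom-P = inverse-preserves₁ hom-P
      }
    }
    where open IsTDLIHom h

  isKIIso : {o : KIOps A} {o′ : KIOps B} → IsKIHom o o′ f → IsKIIso o o′ f
  isKIIso h = record
    { hom = h ; inv = g ; invˡ = g∘f≗id ; invʳ = f∘g≗id
    ; inv-hom = record
      { hom-∧ = inverse-preserves₂ hom-∧ ; hom-∨ = inverse-preserves₂ hom-∨
      ; hom-⇒ = inverse-preserves₂ hom-⇒ ; hom-∼ = inverse-preserves₁ hom-∼
      ; hom-c = inverse-preserves₀ hom-c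
      ; hom-𝟘 = inverse-preserves₀ hom-𝟘 ; hom-𝟙 = inverse-preserves₀ hom-𝟙
      ; hom-G = inverse-preserves₁ hom-G ; hom-H = inverse-preserves₁ hom-H
      }
    }
    where open IsKIHom h

module KObject (L : TDLI0 ℓ) where
  open TDLI0 L using (Carrier; ops; laws)
  open TDLIOps ops
  open IsTDLI0 laws
  open BoundedLatticeOrder _∨_ _∧_ 𝟘 𝟙 isDistLat 𝟙-top 𝟘-bot hiding (_≤_)
  module K = KIOps (KOpsOf L)
  module PG = GaloisConnection P G T1
  module FH = GaloisConnection F H T2

  K-≡ : ∀ {p q r s} {e : p ∧ q ≡ 𝟘} {e′ : r ∧ s ≡ 𝟘}
      → p ≡ r → q ≡ s → _≡_ {A = KCar ops} ((p , q) , e) ((r , s) , e′)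
  K-≡ = KCar-≡ ops

  -- y is explicit: its disjointness proof cannot be recovered from the goal by unification.
  K-≤ : ∀ {p q} {e : p ∧ q ≡ 𝟘} (y : KCar ops)
      → p ≤ proj₁ (proj₁ y) → proj₂ (proj₁ y) ≤ q → ((p , q) , e) K.≤ y
  K-≤ _ p≤r s≤q = K-≡ p≤r (∨-absorbs-≤ s≤q)

  F∧G≤F∧ : ∀ x y → F x ∧ G y ≤ F (x ∧ y)
  F∧G≤F∧ x y = subst₂ _≤_ (∧-comm (G y) (F x)) (cong F (∧-comm y x)) (T3G y x)

  P∧H≤P∧ : ∀ x y → P x ∧ H y ≤ P (x ∧ y)
  P∧H≤P∧ x y = subst₂ _≤_ (∧-comm (H y) (P x)) (cong P (∧-comm y x)) (T3H y x)

  K-isDistributiveLattice : IsDistributiveLattice K._∨_ K._∧_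
  K-isDistributiveLattice = record
    { isLattice = record
      { isEquivalence = isEquivalence
      ; ∨-comm = λ { ((a , b) , _) ((p , q) , _) → K-≡ (∨-comm a p) (∧-comm b q) }
      ; ∨-assoc = λ { ((a , b) , _) ((p , q) , _) ((r , s) , _) →
          K-≡ (∨-assoc a p r) (∧-assoc b q s) }
      ; ∨-cong = cong₂ _
      ; ∧-comm = λ { ((a , b) , _) ((p , q) , _) → K-≡ (∧-comm a p) (∨-comm b q) }
      ; ∧-assoc = λ { ((a , b) , _) ((p , q) , _) ((r , s) , _) →
          K-≡ (∧-assoc a p r) (∨-assoc b q s) }
      ; ∧-cong = cong₂ _
      ; absorptive =
          (λ { ((a , b) , _) ((p , q) , _) → K-≡ (∨-absorbs-∧ a p) (∧-absorbs-∨ b q) })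
        , (λ { ((a , b) , _) ((p , q) , _) → K-≡ (∧-absorbs-∨ a p) (∨-absorbs-∧ b q) })
      }
    ; ∨-distrib-∧ =
        (λ { ((a , b) , _) ((p , q) , _) ((r , s) , _) →
          K-≡ (∨-distribˡ-∧ a p r) (∧-distribˡ-∨ b q s) })
      , (λ { ((a , b) , _) ((p , q) , _) ((r , s) , _) →
          K-≡ (∨-distribʳ-∧ a p r) (∧-distribʳ-∨ b q s) })
    ; ∧-distrib-∨ =
        (λ { ((a , b) , _) ((p , q) , _) ((r , s) , _) →
          K-≡ (∧-distribˡ-∨ a p r) (∨-distribˡ-∧ b q s) })
      , (λ { ((a , b) , _) ((p , q) , _) ((r , s) , _) →
          K-≡ (∧-distribʳ-∨ a p r) (∨-distribʳ-∧ b q s) })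
    }

  K-I1 : ∀ x y z → (x K.⇒ y) K.∧ (x K.⇒ z) ≡ x K.⇒ (y K.∧ z)
  K-I1 ((a , b) , _) ((p , q) , _) ((r , s) , _) =
    K-≡ (trans (∧-interchange _ _ _ _) (cong₂ _∧_ (I1 a p r) (I2 q s b)))
        (sym (∧-distribˡ-∨ a q s))

  K-I2 : ∀ x y z → (x K.⇒ z) K.∧ (y K.⇒ z) ≡ (x K.∨ y) K.⇒ z
  K-I2 ((a , b) , _) ((p , q) , _) ((r , s) , _) =
    K-≡ (trans (∧-interchange _ _ _ _) (cong₂ _∧_ (I2 a p r) (I1 s b q)))
        (sym (∧-distribʳ-∨ s a p))

  K-KI2 : ∀ x y → (x K.∧ (x K.⇒ y)) K.∨ K.c K.≤ y K.∨ K.c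
  K-KI2 ((a , b) , _) y@((p , q) , _) =
    K-≤ (y K.∨ K.c) (∨-mono-≤ (≤-trans (∧-mono-≤ ≤-refl (lb₁ _ _)) (I5 a p)) ≤-refl)
        (≡𝟘⇒≤ (∧-zeroʳ q) _)

  K-KI5 : ∀ x y → (x K.⇒ K.∼ y) K.∨ K.c ≡ (x K.⇒ (K.∼ y K.∨ K.c)) K.∧ (y K.⇒ (K.∼ x K.∨ K.c))
  K-KI5 ((a , b) , _) ((p , q) , _) =
    K-≡ (trans (𝟘-bot _) (sym (cong₂ _∧_ (⇒∨𝟘 a q p b) (⇒∨𝟘 p b a q))))
        (trans (∧-zeroʳ _) (sym (trans (cong₂ _∨_ (∧∧𝟘 a p) (∧∧𝟘 p a)) (𝟘-bot 𝟘))))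
    where
      ⇒∨𝟘 : ∀ u v w t → (u ⇒ (v ∨ 𝟘)) ∧ ((w ∧ 𝟘) ⇒ t) ≡ u ⇒ v
      ⇒∨𝟘 u v w t = trans (cong₂ _∧_ (cong (u ⇒_) (𝟘-bot v))
                                     (trans (cong (_⇒ t) (∧-zeroʳ w)) (I3 t)))
                          (𝟙-top (u ⇒ v))
      ∧∧𝟘 : ∀ u v → u ∧ (v ∧ 𝟘) ≡ 𝟘
      ∧∧𝟘 u v = trans (cong (u ∧_) (∧-zeroʳ v)) (∧-zeroʳ u)

  K-CK : ∀ x y → K.c K.≤ x → K.c K.≤ y → x K.∧ y K.≤ K.c
       → Σ (KCar ops) (λ z → (z K.∨ K.c ≡ x) × (K.∼ z K.∨ K.c ≡ y))
  K-CK ((a , b) , _) ((p , q) , _) c≤x c≤y x∧y≤c =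
    ((a , p) , a∧p≡𝟘) , K-≡ (𝟘-bot a) (trans (∧-zeroʳ p) (sym b≡𝟘))
                      , K-≡ (𝟘-bot p) (trans (∧-zeroʳ a) (sym q≡𝟘))
    where
      b≡𝟘 : b ≡ 𝟘
      b≡𝟘 = trans (sym (∨-identityˡ b)) (cong (proj₂ ∘ proj₁) c≤x)
      q≡𝟘 : q ≡ 𝟘
      q≡𝟘 = trans (sym (∨-identityˡ q)) (cong (proj₂ ∘ proj₁) c≤y)
      a∧p≡𝟘 : a ∧ p ≡ 𝟘
      a∧p≡𝟘 = trans (sym (cong (proj₁ ∘ proj₁) x∧y≤c)) (∧-zeroʳ _)

  isItKIc : IsItKIc (KOpsOf L)
  isItKIc = record
    { isDistLat = K-isDistributiveLattice
    ; 𝟙-top = λ { ((a , b) , _) → K-≡ (𝟙-top a) (𝟘-bot b) }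
    ; 𝟘-bot = λ { ((a , b) , _) → K-≡ (𝟘-bot a) (𝟙-top b) }
    ; ∼∼ = λ _ → K-≡ refl refl
    ; ∼-∨ = λ _ _ → K-≡ refl refl
    ; kleene = λ { ((a , b) , e) y@((p , q) , e′) →
        K-≤ (y K.∨ K.∼ y) (≡𝟘⇒≤ e _) (≡𝟘⇒≤ (trans (∧-comm q p) e′) _) }
    ; ∼c = K-≡ refl refl
    ; I1 = K-I1
    ; I2 = K-I2
    ; I3 = λ { ((a , b) , _) → K-≡ (trans (cong₂ _∧_ (I3 a) (I4 b)) (∧-idem 𝟙)) (∧-zeroˡ b) }
    ; I4 = λ { ((a , b) , _) → K-≡ (trans (cong₂ _∧_ (I4 a) (I3 b)) (∧-idem 𝟙)) (∧-zeroʳ a) }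
    ; KI2 = K-KI2
    ; KI3 = K-≡ (trans (cong₂ _∧_ (I3 𝟘) (I3 𝟘)) (∧-idem 𝟙)) (∧-idem 𝟘)
    ; KI4 = λ _ _ → K-≡ (trans (∧-zeroʳ _) (sym (∧-zeroʳ _))) refl
    ; KI5 = K-KI5
    ; t1G = K-≡ PG.r-𝟙 FH.l-𝟘
    ; t1H = K-≡ FH.r-𝟙 PG.l-𝟘
    ; t2G = λ { ((a , b) , _) ((p , q) , _) → K-≡ (PG.r-∧ a p) (FH.l-∨ b q) }
    ; t2H = λ { ((a , b) , _) ((p , q) , _) → K-≡ (FH.r-∧ a p) (PG.l-∨ b q) }
    ; t3G = λ { x@((a , b) , _) → K-≤ (K.G (K.P x)) (PG.unit a) (FH.counit b) }
    ; t3H = λ { x@((a , b) , _) → K-≤ (K.H (K.F x)) (FH.unit a) (PG.counit b) }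
    ; t4G = λ { x@((a , b) , _) y@((p , q) , _) →
        K-≤ (K.G x K.∨ K.F y) (T4G a p) (F∧G≤F∧ b q) }
    ; t4H = λ { x@((a , b) , _) y@((p , q) , _) →
        K-≤ (K.H x K.∨ K.P y) (T4H a p) (P∧H≤P∧ b q) }
    ; t5G = λ { x@((a , b) , _) y@((p , q) , _) → K-≤ (K.G x K.⇒ K.G y)
        (≤-respˡ-≡ (sym (PG.r-∧ _ _)) (∧-mono-≤ (T5G a p) (T6G q b))) (T3G a q) }
    ; t5H = λ { x@((a , b) , _) y@((p , q) , _) → K-≤ (K.H x K.⇒ K.H y)
        (≤-respˡ-≡ (sym (FH.r-∧ _ _)) (∧-mono-≤ (T5H a p) (T6H q b))) (T3H a q) }
    ; t6G = λ { x@((a , b) , _) y@((p , q) , _) → K-≤ (K.F x K.⇒ K.F y)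
        (≤-respˡ-≡ (sym (PG.r-∧ _ _)) (∧-mono-≤ (T6G a p) (T5G q b))) (F∧G≤F∧ a q) }
    ; t6H = λ { x@((a , b) , _) y@((p , q) , _) → K-≤ (K.P x K.⇒ K.P y)
        (≤-respˡ-≡ (sym (FH.r-∧ _ _)) (∧-mono-≤ (T6H a p) (T5H q b))) (P∧H≤P∧ a q) }
    ; Gc = K-≡ G𝟘 FH.l-𝟘
    ; Hc = K-≡ H𝟘 PG.l-𝟘
    ; CK = K-CK
    }

  CK-≡ : ∀ {p q r s} {e : p ∧ q ≡ 𝟘} {e′ : r ∧ s ≡ 𝟘} {c≤pq c≤rs}
       → p ≡ r → q ≡ s
       → _≡_ {A = CCar (KOpsOf L)} (((p , q) , e) , c≤pq) (((r , s) , e′) , c≤rs)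
  CK-≡ p≡r q≡s = CCar-≡ (KOpsOf L) (K-≡ p≡r q≡s)

  α-isHom : IsTDLIHom ops (COpsOf (KObj L isItKIc)) (α L)
  α-isHom = record
    { hom-∧ = λ _ _ → CK-≡ refl (sym (𝟘-bot 𝟘))
    ; hom-∨ = λ _ _ → CK-≡ refl (sym (∧-idem 𝟘))
    ; hom-⇒ = λ x y → CK-≡ (sym (trans (cong ((x ⇒ y) ∧_) (I3 𝟘)) (𝟙-top _))) (sym (∧-zeroʳ x))
    ; hom-𝟘 = CK-≡ refl refl
    ; hom-𝟙 = CK-≡ refl refl
    ; hom-G = λ _ → CK-≡ refl (sym FH.l-𝟘)
    ; hom-H = λ _ → CK-≡ refl (sym PG.l-𝟘)
    ; hom-F = λ _ → CK-≡ refl (sym G𝟘)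
    ; hom-P = λ _ → CK-≡ refl (sym H𝟘)
    }

  α⁻¹ : CCar (KOpsOf L) → Carrier
  α⁻¹ (((a , _) , _) , _) = a

  α∘α⁻¹≗id : ∀ z → α L (α⁻¹ z) ≡ z
  α∘α⁻¹≗id (((a , b) , _) , c≤ab) =
    CK-≡ refl (sym (trans (sym (∨-identityˡ b)) (cong (proj₂ ∘ proj₁) c≤ab)))

  α-isIso : IsTDLIIso ops (COpsOf (KObj L isItKIc)) (α L)
  α-isIso = isTDLIIso (λ _ → refl) α∘α⁻¹≗id α-isHom

module KIFacts {T : Set ℓ} (o : KIOps T) (l : IsItKIc o) where
  open KIOps o hiding (G; H; F; P)
  open IsItKIc l
  open BoundedLatticeOrder _∨_ _∧_ 𝟘 𝟙 isDistLat 𝟙-top 𝟘-bot public hiding (_≤_)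
  open Involution ∼ ∼∼ ∼-∨ public

  ∼∨c≡∼[∧c] : ∀ x → ∼ x ∨ c ≡ ∼ (x ∧ c)
  ∼∨c≡∼[∧c] x = sym (trans (∼-∧ x c) (cong (∼ x ∨_) ∼c))

  ⇒-monoʳ-≤ : ∀ {x y z} → y ≤ z → (x ⇒ y) ≤ (x ⇒ z)
  ⇒-monoʳ-≤ {x} {y} {z} p = trans (I1 x y z) (cong (x ⇒_) p)

  c⇒≡𝟙 : ∀ {x} → c ≤ x → c ⇒ x ≡ 𝟙
  c⇒≡𝟙 c≤x = 𝟙≤⇒≡𝟙 (≤-respˡ-≡ KI3 (⇒-monoʳ-≤ c≤x))

  ∨c⇒ : ∀ x {y} → c ≤ y → (x ∨ c) ⇒ y ≡ x ⇒ y
  ∨c⇒ x {y} c≤y = trans (sym (I2 x c y)) (trans (cong ((x ⇒ y) ∧_) (c⇒≡𝟙 c≤y)) (𝟙-top _))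

  ⇒-∨c : ∀ x y → (x ⇒ y) ∨ c ≡ ((x ∨ c) ⇒ (y ∨ c)) ∧ ((∼ y ∨ c) ⇒ (∼ x ∨ c))
  ⇒-∨c x y = begin
    (x ⇒ y) ∨ c
      ≡⟨ cong (λ u → (x ⇒ u) ∨ c) (sym (∼∼ y)) ⟩
    (x ⇒ ∼ (∼ y)) ∨ c
      ≡⟨ KI5 x (∼ y) ⟩
    (x ⇒ (∼ (∼ y) ∨ c)) ∧ (∼ y ⇒ (∼ x ∨ c))
      ≡⟨ cong₂ _∧_ (cong (λ u → x ⇒ (u ∨ c)) (∼∼ y)) refl ⟩
    (x ⇒ (y ∨ c)) ∧ (∼ y ⇒ (∼ x ∨ c))
      ≡⟨ sym (cong₂ _∧_ (∨c⇒ x (y≤x∨y y c)) (∨c⇒ (∼ y) (y≤x∨y (∼ x) c))) ⟩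
    ((x ∨ c) ⇒ (y ∨ c)) ∧ ((∼ y ∨ c) ⇒ (∼ x ∨ c))
      ∎
    where open ≡-Reasoning

  ∼[⇒]-∨c : ∀ x y → ∼ (x ⇒ y) ∨ c ≡ (x ∨ c) ∧ (∼ y ∨ c)
  ∼[⇒]-∨c x y = begin
    ∼ (x ⇒ y) ∨ c             ≡⟨ ∼∨c≡∼[∧c] (x ⇒ y) ⟩
    ∼ ((x ⇒ y) ∧ c)           ≡⟨ cong ∼ (KI4 x y) ⟩
    ∼ ((∼ x ∨ y) ∧ c)         ≡⟨ sym (∼∨c≡∼[∧c] (∼ x ∨ y)) ⟩
    ∼ (∼ x ∨ y) ∨ c           ≡⟨ cong (_∨ c) (trans (∼-∨ (∼ x) y) (cong (_∧ ∼ y) (∼∼ x))) ⟩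
    (x ∧ ∼ y) ∨ c             ≡⟨ ∨-distribʳ-∧ c x (∼ y) ⟩
    (x ∨ c) ∧ (∼ y ∨ c)       ∎
    where open ≡-Reasoning

  ∨c-∼∨c-injective : ∀ {x y} → x ∨ c ≡ y ∨ c → ∼ x ∨ c ≡ ∼ y ∨ c → x ≡ y
  ∨c-∼∨c-injective {x} {y} ∨c≡ ∼∨c≡ = ∧-∨-cancelʳ ∧c≡ ∨c≡
    where
      ∧c≡ : x ∧ c ≡ y ∧ c
      ∧c≡ = begin
        x ∧ c             ≡⟨ sym (∼∼ _) ⟩
        ∼ (∼ (x ∧ c))     ≡⟨ cong ∼ (sym (∼∨c≡∼[∧c] x)) ⟩
        ∼ (∼ x ∨ c)       ≡⟨ cong ∼ ∼∨c≡ ⟩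
        ∼ (∼ y ∨ c)       ≡⟨ cong ∼ (∼∨c≡∼[∧c] y) ⟩
        ∼ (∼ (y ∧ c))     ≡⟨ ∼∼ _ ⟩
        y ∧ c             ∎
        where open ≡-Reasoning

  module TenseDirection (G H : Op₁ T)
    (G-∧ : ∀ x y → G (x ∧ y) ≡ G x ∧ G y) (H-∧ : ∀ x y → H (x ∧ y) ≡ H x ∧ H y)
    (x≤GPx : ∀ x → x ≤ G (∼ (H (∼ x)))) (x≤HFx : ∀ x → x ≤ H (∼ (G (∼ x))))
    (G-∨ : ∀ x y → G (x ∨ y) ≤ G x ∨ ∼ (G (∼ y))) (G-c : G c ≡ c) where

    F P : Op₁ T
    F x = ∼ (G (∼ x))
    P x = ∼ (H (∼ x))

    G-mono : ∀ {x y} → x ≤ y → G x ≤ G y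
    G-mono {x} {y} p = trans (sym (G-∧ x y)) (cong G p)

    P-mono : ∀ {x y} → x ≤ y → P x ≤ P y
    P-mono {x} {y} p = ∼-antitone (trans (sym (H-∧ (∼ y) (∼ x))) (cong H (∼-antitone p)))

    PGx≤x : ∀ x → P (G x) ≤ x
    PGx≤x x = subst (λ u → P (G u) ≤ u) (∼∼ x) (∼-antitone (x≤HFx (∼ x)))

    P⊣G : ∀ x y → (P x ≤ y) ⇔ (x ≤ G y)
    P⊣G x y = mk⇔ (λ Px≤y → ≤-trans (x≤GPx x) (G-mono Px≤y))
                  (λ x≤Gy → ≤-trans (P-mono x≤Gy) (PGx≤x y))

    F-∨ : ∀ x y → F (x ∨ y) ≡ F x ∨ F y
    F-∨ x y = trans (cong (λ u → ∼ (G u)) (∼-∨ x y))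
                    (trans (cong ∼ (G-∧ (∼ x) (∼ y))) (∼-∧ _ _))

    F-c : F c ≡ c
    F-c = trans (cong (λ u → ∼ (G u)) ∼c) (trans (cong ∼ G-c) ∼c)

    G∧F≤F∧ : ∀ x y → G x ∧ F y ≤ F (x ∧ y)
    G∧F≤F∧ x y = subst₂ _≤_ lhs rhs (∼-antitone (G-∨ (∼ y) (∼ x)))
      where
        lhs : ∼ (G (∼ y) ∨ F (∼ x)) ≡ G x ∧ F y
        lhs = trans (∼-∨ (G (∼ y)) (F (∼ x)))
                    (trans (cong (F y ∧_) (trans (∼∼ _) (cong G (∼∼ x)))) (∧-comm (F y) (G x)))
        rhs : ∼ (G (∼ y ∨ ∼ x)) ≡ F (x ∧ y)
        rhs = cong (λ u → ∼ (G u)) (trans (sym (∼-∧ y x)) (cong ∼ (∧-comm y x)))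

    G-∨c : ∀ x → G (x ∨ c) ≡ G x ∨ c
    G-∨c x = ≤-antisym (≤-respʳ-≡ (cong (G x ∨_) F-c) (G-∨ x c))
      (∨-least (G-mono (x≤x∨y x c)) (≤-respˡ-≡ G-c (G-mono (y≤x∨y x c))))

    F-∼∨c : ∀ x → F (∼ x ∨ c) ≡ ∼ (G x) ∨ c
    F-∼∨c x = trans (F-∨ (∼ x) c) (cong₂ _∨_ (cong (λ u → ∼ (G u)) (∼∼ x)) F-c)

module CObject (U : ItKIc ℓ) where
  open ItKIc U using (Carrier; ops; laws)
  open KIOps ops
  open IsItKIc laws
  open KIFacts ops laws
  module GH = TenseDirection G H t2G t2H t3G t3H t4G Gc
  module HG = TenseDirection H G t2H t2G t3H t3G t4H Hc
  module C = TDLIOps (COpsOf U)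

  C-≡ : ∀ {x y} {p : c ∧ x ≡ c} {q : c ∧ y ≡ c} → x ≡ y → _≡_ {A = CCar ops} (x , p) (y , q)
  C-≡ = CCar-≡ ops

  C-≤ : ∀ {x y} {p : c ∧ x ≡ c} {q : c ∧ y ≡ c} → x ≤ y → (x , p) C.≤ (y , q)
  C-≤ = C-≡

  C-≤-⇔ : ∀ {x y u v} {px : c ∧ x ≡ c} {py : c ∧ y ≡ c} {pu : c ∧ u ≡ c} {pv : c ∧ v ≡ c}
        → (x ≤ y) ⇔ (u ≤ v) → ((x , px) C.≤ (y , py)) ⇔ ((u , pu) C.≤ (v , pv))
  C-≤-⇔ x≤y⇔u≤v = mk⇔ (λ p → C-≤ (Equivalence.to x≤y⇔u≤v (cong proj₁ p)))
                       (λ q → C-≤ (Equivalence.from x≤y⇔u≤v (cong proj₁ q)))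

  C-isDistributiveLattice : IsDistributiveLattice C._∨_ C._∧_
  C-isDistributiveLattice = record
    { isLattice = record
      { isEquivalence = isEquivalence
      ; ∨-comm = λ { (x , _) (y , _) → C-≡ (∨-comm x y) }
      ; ∨-assoc = λ { (x , _) (y , _) (z , _) → C-≡ (∨-assoc x y z) }
      ; ∨-cong = cong₂ _
      ; ∧-comm = λ { (x , _) (y , _) → C-≡ (∧-comm x y) }
      ; ∧-assoc = λ { (x , _) (y , _) (z , _) → C-≡ (∧-assoc x y z) }
      ; ∧-cong = cong₂ _
      ; absorptive = (λ { (x , _) (y , _) → C-≡ (∨-absorbs-∧ x y) })
                   , (λ { (x , _) (y , _) → C-≡ (∧-absorbs-∨ x y) })
      }
    ; ∨-distrib-∧ = (λ { (x , _) (y , _) (z , _) → C-≡ (∨-distribˡ-∧ x y z) })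
                  , (λ { (x , _) (y , _) (z , _) → C-≡ (∨-distribʳ-∧ x y z) })
    ; ∧-distrib-∨ = (λ { (x , _) (y , _) (z , _) → C-≡ (∧-distribˡ-∨ x y z) })
                  , (λ { (x , _) (y , _) (z , _) → C-≡ (∧-distribʳ-∨ x y z) })
    }

  C-I5 : ∀ x y → x C.∧ (x C.⇒ y) C.≤ y
  C-I5 X@(x , _) Y@(y , c≤y) =
    C-≤ (subst₂ _≤_ (∨-absorbs-≤ (proj₂ (X C.∧ (X C.⇒ Y)))) (∨-absorbs-≤ c≤y) (KI2 x y))

  isTDLI0 : IsTDLI0 (COpsOf U)
  isTDLI0 = record
    { isDistLat = C-isDistributiveLattice
    ; 𝟙-top = λ { (x , _) → C-≡ (𝟙-top x) }
    ; 𝟘-bot = λ { (x , c≤x) → C-≡ (∨-absorbs-≤ c≤x) }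
    ; I1 = λ { (x , _) (y , _) (z , _) → C-≡ (I1 x y z) }
    ; I2 = λ { (x , _) (y , _) (z , _) → C-≡ (I2 x y z) }
    ; I3 = λ { (x , c≤x) → C-≡ (c⇒≡𝟙 c≤x) }
    ; I4 = λ { (x , _) → C-≡ (I4 x) }
    ; I5 = C-I5
    ; T1 = λ { (x , _) (y , _) → C-≤-⇔ (GH.P⊣G x y) }
    ; T2 = λ { (x , _) (y , _) → C-≤-⇔ (HG.P⊣G x y) }
    ; T3G = λ { (x , _) (y , _) → C-≤ (GH.G∧F≤F∧ x y) }
    ; T3H = λ { (x , _) (y , _) → C-≤ (HG.G∧F≤F∧ x y) }
    ; T4G = λ { (x , _) (y , _) → C-≤ (t4G x y) }
    ; T4H = λ { (x , _) (y , _) → C-≤ (t4H x y) }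
    ; T5G = λ { (x , _) (y , _) → C-≤ (t5G x y) }
    ; T5H = λ { (x , _) (y , _) → C-≤ (t5H x y) }
    ; T6G = λ { (x , _) (y , _) → C-≤ (t6G x y) }
    ; T6H = λ { (x , _) (y , _) → C-≤ (t6H x y) }
    ; G𝟘 = C-≡ Gc
    ; H𝟘 = C-≡ Hc
    }

  module KC = KIOps (KOpsOf (CObj U isTDLI0))

  KC-≡ : ∀ {X Y X′ Y′ : CCar ops} {e : X C.∧ Y ≡ C.𝟘} {e′ : X′ C.∧ Y′ ≡ C.𝟘}
       → proj₁ X ≡ proj₁ X′ → proj₁ Y ≡ proj₁ Y′
       → _≡_ {A = KCar (COpsOf U)} ((X , Y) , e) ((X′ , Y′) , e′)
  KC-≡ x≡x′ y≡y′ = KCar-≡ (COpsOf U) (C-≡ x≡x′) (C-≡ y≡y′)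

  β-isHom : IsKIHom ops (KOpsOf (CObj U isTDLI0)) (β U)
  β-isHom = record
    { hom-∧ = λ x y → KC-≡ (∨-distribʳ-∧ c x y)
                          (trans (cong (_∨ c) (∼-∧ x y)) (∨-distribʳ-∨ (∼ x) (∼ y) c))
    ; hom-∨ = λ x y → KC-≡ (∨-distribʳ-∨ x y c)
                          (trans (cong (_∨ c) (∼-∨ x y)) (∨-distribʳ-∧ c (∼ x) (∼ y)))
    ; hom-⇒ = λ x y → KC-≡ (⇒-∨c x y) (∼[⇒]-∨c x y)
    ; hom-∼ = λ x → KC-≡ refl (cong (_∨ c) (∼∼ x))
    ; hom-c = KC-≡ (∨-idem c) (trans (cong (_∨ c) ∼c) (∨-idem c))
    ; hom-𝟘 = KC-≡ (∨-identityˡ c) (trans (cong (_∨ c) ∼-𝟘) (∨-zeroˡ c))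
    ; hom-𝟙 = KC-≡ (∨-zeroˡ c) (trans (cong (_∨ c) ∼-𝟙) (∨-identityˡ c))
    ; hom-G = λ x → KC-≡ (sym (GH.G-∨c x)) (sym (GH.F-∼∨c x))
    ; hom-H = λ x → KC-≡ (sym (HG.G-∨c x)) (sym (HG.F-∼∨c x))
    }

  β-injective : ∀ {x y} → β U x ≡ β U y → x ≡ y
  β-injective βx≡βy = ∨c-∼∨c-injective (cong (proj₁ ∘ proj₁ ∘ proj₁) βx≡βy)
                                       (cong (proj₁ ∘ proj₂ ∘ proj₁) βx≡βy)

  β-surjective : ∀ z → Σ Carrier (λ x → β U x ≡ z)
  β-surjective (((a , c≤a) , (b , c≤b)) , a∧b≡c) =
    proj₁ ck , KC-≡ (proj₁ (proj₂ ck)) (proj₂ (proj₂ ck))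
    where
      a∧b≤c : a ∧ b ≤ c
      a∧b≤c = ≤-respˡ-≡ (sym (cong proj₁ a∧b≡c)) ≤-refl
      ck = CK a b c≤a c≤b a∧b≤c

  β-isIso : IsKIIso ops (KOpsOf (CObj U isTDLI0)) (β U)
  β-isIso = isKIIso (λ x → β-injective (proj₂ (β-surjective (β U x))))
                    (proj₂ ∘ β-surjective) β-isHom

module _ (L M : TDLI0 ℓ) {f : TDLI0.Carrier L → TDLI0.Carrier M}
         (hf : IsTDLIHom (TDLI0.ops L) (TDLI0.ops M) f) where
  open IsTDLIHom hf
  private
    module M = TDLIOps (TDLI0.ops M)
    K-≡ = KCar-≡ (TDLI0.ops M)

  Kmap-isHom : IsKIHom (KOpsOf L) (KOpsOf M) (Kmap f hf)
  Kmap-isHom = record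
    { hom-∧ = λ { ((p , q) , _) ((r , s) , _) → K-≡ (hom-∧ p r) (hom-∨ q s) }
    ; hom-∨ = λ { ((p , q) , _) ((r , s) , _) → K-≡ (hom-∨ p r) (hom-∧ q s) }
    ; hom-⇒ = λ { ((p , q) , _) ((r , s) , _) →
        K-≡ (trans (hom-∧ _ _) (cong₂ M._∧_ (hom-⇒ p r) (hom-⇒ s q))) (hom-∧ p s) }
    ; hom-∼ = λ _ → K-≡ refl refl
    ; hom-c = K-≡ hom-𝟘 hom-𝟘
    ; hom-𝟘 = K-≡ hom-𝟘 hom-𝟙
    ; hom-𝟙 = K-≡ hom-𝟙 hom-𝟘
    ; hom-G = λ { ((p , q) , _) → K-≡ (hom-G p) (hom-F q) }
    ; hom-H = λ { ((p , q) , _) → K-≡ (hom-H p) (hom-P q) }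
    }

  α-natural : ∀ x → Cmap (Kmap f hf) Kmap-isHom (α L x) ≡ α M (f x)
  α-natural _ = CCar-≡ (KOpsOf M) (K-≡ refl hom-𝟘)

module _ (U V : ItKIc ℓ) {g : ItKIc.Carrier U → ItKIc.Carrier V}
         (hg : IsKIHom (ItKIc.ops U) (ItKIc.ops V) g) where
  open IsKIHom hg
  private
    module U = KIOps (ItKIc.ops U)
    module V = KIOps (ItKIc.ops V)
    C-≡ = CCar-≡ (ItKIc.ops V)

  Cmap-isHom : IsTDLIHom (COpsOf U) (COpsOf V) (Cmap g hg)
  Cmap-isHom = record
    { hom-∧ = λ { (x , _) (y , _) → C-≡ (hom-∧ x y) }
    ; hom-∨ = λ { (x , _) (y , _) → C-≡ (hom-∨ x y) }
    ; hom-⇒ = λ { (x , _) (y , _) → C-≡ (hom-⇒ x y) }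
    ; hom-𝟘 = C-≡ hom-c
    ; hom-𝟙 = C-≡ hom-𝟙
    ; hom-G = λ { (x , _) → C-≡ (hom-G x) }
    ; hom-H = λ { (x , _) → C-≡ (hom-H x) }
    ; hom-F = λ { (x , _) → C-≡ (hom-F x) }
    ; hom-P = λ { (x , _) → C-≡ (hom-P x) }
    }
    where
      hom-F : ∀ x → g (U.F x) ≡ V.F (g x)
      hom-F x = trans (hom-∼ _) (cong V.∼ (trans (hom-G _) (cong V.G (hom-∼ x))))
      hom-P : ∀ x → g (U.P x) ≡ V.P (g x)
      hom-P x = trans (hom-∼ _) (cong V.∼ (trans (hom-H _) (cong V.H (hom-∼ x))))

  β-natural : ∀ x → Kmap (Cmap g hg) Cmap-isHom (β U x) ≡ β V (g x)
  β-natural x = KCar-≡ (COpsOf V) (C-≡ (trans (hom-∨ x U.c) (cong (g x V.∨_) hom-c)))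
                                  (C-≡ (trans (hom-∨ _ _) (cong₂ V._∨_ (hom-∼ x) hom-c)))

theorem5p7 : ∀ {a : Level} → KCEquivalence a
theorem5p7 = record
  { K-obj  = KObject.isItKIc
  ; K-hom  = λ L M _ → Kmap-isHom L M
  ; K-id   = λ L _ _ → KCar-≡ (TDLI0.ops L) refl refl
  ; K-comp = λ _ _ N _ _ _ _ _ _ → KCar-≡ (TDLI0.ops N) refl refl
  ; C-obj  = CObject.isTDLI0
  ; C-hom  = λ U V _ → Cmap-isHom U V
  ; C-id   = λ U _ _ → CCar-≡ (ItKIc.ops U) refl
  ; C-comp = λ _ _ W _ _ _ _ _ _ → CCar-≡ (ItKIc.ops W) refl
  ; α-iso  = KObject.α-isIso
  ; α-nat  = λ L M _ → α-natural L M
  ; β-iso  = CObject.β-isIso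
  ; β-nat  = λ U V _ → β-natural U V
  }
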